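{- $G^{\mathrm{Pink}}_{3,2,\infty}=\tilde B_{3,2,\infty}$.
   Context: $T_\infty$ is the infinite binary rooted tree whose nodes are finite words in $\{a,b\}$ (root = empty word, $w$ joined to $wa,wb$), with automorphism group $\mathrm{Aut}(T_\infty)$ (profinite topology). For $\sigma\in\mathrm{Aut}(T_\infty)$ and a word $x$, $\mathrm{Par}(\sigma,x)\in\mathbb{Z}/2\mathbb{Z}$ is $0$ if $\sigma(xa)=\sigma(x)a$ and $1$ if $\sigma(xa)=\sigma(x)b$. Define $P^a_{3,2}(\sigma,x)=\sum_{w\in\{a,b\}^2}\mathrm{Par}(\sigma,xaw)+\sum_{w'\in\{a,b\}}\mathrm{Par}(\sigma,xbw')$ and $P^b_{3,2}(\sigma,x)=\sum_{w\in\{a,b\}^2}\mathrm{Par}(\sigma,xbw)+\sum_{w'\in\{a,b\}}\mathrm{Par}(\sigma,xaw')$; $M_{3,2,\infty}$ is the set of $\sigma$ for which all these values (over all nodes $x$) coincide, with common value $P_{3,2}(\sigma)$, and $B_{3,2,\infty}=\{\sigma\in M_{3,2,\infty}:P_{3,2}(\sigma)=0\}$. Define $R_{3,2}(\sigma,x)=\sum_{w\in\{a,b\}^2}\big[\mathrm{Par}(\sigma,xw)+\mathrm{Par}(\sigma,xwb)+\sum_{t\in\{a,b\}}\mathrm{Par}(\sigma,xwat)\big]+[\mathrm{Par}(\sigma,xaa)+\mathrm{Par}(\sigma,xab)][\mathrm{Par}(\sigma,xba)+\mathrm{Par}(\sigma,xbb)]\in\mathbb{Z}/2\mathbb{Z}$.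 $\tilde M_{3,2,\infty}$ is the set of $\sigma\in M_{3,2,\infty}$ with $R_{3,2}(\sigma,x)$ independent of $x$ (common value $R_{3,2}(\sigma)$), and $\tilde B_{3,2,\infty}=\{\sigma\in\tilde M_{3,2,\infty}\cap B_{3,2,\infty}:R_{3,2}(\sigma)=0\}$. Pink's group: $G^{\mathrm{Pink}}_{3,2,\infty}$ is the closure of the subgroup generated by $\alpha_1,\alpha_2,\alpha_3\in\mathrm{Aut}(T_\infty)$, where $\mathrm{Par}(\alpha_1,x)=1$ iff $x$ is the root, $\mathrm{Par}(\alpha_2,x)=1$ iff $x=a$, and $\mathrm{Par}(\alpha_3,w)=1$ iff $w=b^naa$ for some $n\ge0$ (equivalently $\alpha_1=\tau$, $\alpha_2=(\tau,1)$, $\alpha_3=(\alpha_2,\alpha_3)$, where $(\alpha,\beta)$ acts as $\alpha$ on the subtree above $a$ and as $\beta$ on that above $b$, fixing $a$ and $b$). -}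

module Defs where

open import Data.Bool using (Bool; true; false; _xor_; _∧_; not)
open import Data.List using (List; []; _∷_; _++_; length)
open import Data.Nat using (ℕ; _<_)
open import Data.Fin using (Fin; zero; suc)
open import Data.Product using (Σ; _×_; proj₁; proj₂)
open import Relation.Binary.PropositionalEquality using (_≡_)

-- Letters of the alphabet {a,b}; nodes of T_∞ are finite words (read from the root).
data Letter : Set where
  a b : Letter

Word : Set
Word = List Letter

-- Z/2Z is represented by Bool (false = 0, true = 1, _xor_ = +, _∧_ = ·).
flip : Bool → Letter → Letter
flip false c = c
flip true a = b
flip true b = a

-- An automorphism of T_∞ is determined by, and freely determined by, its
-- portrait x ↦ Par(σ,x) ∈ Z/2Z.  We represent Aut(T_∞) by portraits.
Aut : Set
Aut = Word → Bool

Par : Aut → Word → Bool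
Par σ x = σ x

act : Aut → Word → Word
act σ [] = []
act σ (c ∷ y) = flip (σ []) c ∷ act (λ z → σ (c ∷ z)) y

invAct : Aut → Word → Word
invAct σ [] = []
invAct σ (c ∷ y) = flip (σ []) c ∷ invAct (λ z → σ (flip (σ []) c ∷ z)) y

_∘ₐ_ : Aut → Aut → Aut
(σ ∘ₐ τ) x = τ x xor σ (act τ x)

inv : Aut → Aut
inv σ x = σ (invAct σ x)

idₐ : Aut
idₐ x = false

α₁ : Aut
α₁ [] = true
α₁ (_ ∷ _) = false

α₂ : Aut
α₂ (a ∷ []) = true
α₂ _ = false

α₃ : Aut
α₃ (b ∷ y) = α₃ y
α₃ (a ∷ a ∷ []) = true
α₃ _ = false

gen : Fin 3 → Aut
gen zero = α₁
gen (suc zero) = α₂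
gen (suc (suc zero)) = α₃

-- words in the generators and their inverses (Bool = "inverted?")
GenWord : Set
GenWord = List (Fin 3 × Bool)

evalGen : GenWord → Aut
evalGen [] = idₐ
evalGen ((i Data.Product., false) ∷ w) = gen i ∘ₐ evalGen w
evalGen ((i Data.Product., true) ∷ w) = inv (gen i) ∘ₐ evalGen w

InGenerated : Aut → Set
InGenerated σ = Σ GenWord λ w → ∀ x → evalGen w x ≡ σ x

-- profinite closure: σ lies in the closure of H iff for every level n there is
-- an element of H agreeing with σ on the first n levels (all nodes of length < n),
-- i.e. in every basic open neighbourhood of σ there is an element of H.
InClosureOfGenerated : Aut → Set
InClosureOfGenerated σ =
  ∀ (n : ℕ) → Σ GenWord λ w → ∀ x → length x < n → evalGen w x ≡ σ x

GPink : Aut → Set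
GPink = InClosureOfGenerated

P-a : Aut → Word → Bool
P-a σ x =
  (Par σ (x ++ a ∷ a ∷ a ∷ []) xor Par σ (x ++ a ∷ a ∷ b ∷ [])
   xor Par σ (x ++ a ∷ b ∷ a ∷ []) xor Par σ (x ++ a ∷ b ∷ b ∷ []))
  xor (Par σ (x ++ b ∷ a ∷ []) xor Par σ (x ++ b ∷ b ∷ []))

P-b : Aut → Word → Bool
P-b σ x =
  (Par σ (x ++ b ∷ a ∷ a ∷ []) xor Par σ (x ++ b ∷ a ∷ b ∷ [])
   xor Par σ (x ++ b ∷ b ∷ a ∷ []) xor Par σ (x ++ b ∷ b ∷ b ∷ []))
  xor (Par σ (x ++ a ∷ a ∷ []) xor Par σ (x ++ a ∷ b ∷ []))

R-term : Aut → Word → Word → Bool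
R-term σ x w =
  Par σ (x ++ w) xor Par σ (x ++ w ++ b ∷ [])
  xor (Par σ (x ++ w ++ a ∷ a ∷ []) xor Par σ (x ++ w ++ a ∷ b ∷ []))

R : Aut → Word → Bool
R σ x =
  (R-term σ x (a ∷ a ∷ []) xor R-term σ x (a ∷ b ∷ [])
   xor R-term σ x (b ∷ a ∷ []) xor R-term σ x (b ∷ b ∷ []))
  xor ((Par σ (x ++ a ∷ a ∷ []) xor Par σ (x ++ a ∷ b ∷ []))
       ∧ (Par σ (x ++ b ∷ a ∷ []) xor Par σ (x ++ b ∷ b ∷ [])))

-- M_{3,2,∞}: all values P^a(σ,x), P^b(σ,x) coincide; the witness is P_{3,2}(σ)
M : Aut → Set
M σ = Σ Bool λ c → ∀ x → (P-a σ x ≡ c) × (P-b σ x ≡ c)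

B : Aut → Set
B σ = Σ (M σ) λ m → proj₁ m ≡ false

-- M̃_{3,2,∞}: additionally R(σ,x) independent of x (witness = R_{3,2}(σ))
M̃ : Aut → Set
M̃ σ = M σ × Σ Bool λ r → ∀ x → R σ x ≡ r

B̃ : Aut → Set
B̃ σ = Σ (M̃ σ) λ m → (proj₁ (proj₁ m) ≡ false) × (proj₁ (proj₂ m) ≡ false)

-- Let T(σ, x) collect P^a(σ, x), P^b(σ, x) and R(σ, x), so that B̃ consists
-- of the σ with T(σ, x) = 0 at every node x.  These values are computed from
-- the level sums of the two sections of σ at x, so if ρ is a product of
-- generators, T(ρ ∘ σ, x) differs from T(σ, x) by corrections coming from the
-- section of ρ at σ(x).  The sections of α₁, α₂, α₃ are again among 1, α₁, α₂,
-- α₃, and for each generator the corrections from its two sections cancel;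
-- hence T ≡ 0 on Pink's group, and on its closure, since T at x only reads
-- the levels |x| + 1, …, |x| + 4.
--
-- Conversely let T(σ) ≡ 0 and let w be a word agreeing with σ below level n.
-- The discrepancy on level n is a pattern subject to the linear conditions
-- coming from the deepest nodes in T, so it suffices to realize every such
-- pattern by a product of generators that is trivial below level n.  For
-- n ≤ 4 this is a finite computation with explicit words.  For larger n one
-- uses the substitution L on words, which satisfies L(w) = (w, ψ(w)) and sends
-- x = α₁α₂α₃α₁α₃α₂ to a product of two conjugates of x, while ψ(x) = 1; hence
-- products of conjugates of x realizing patterns on level n can be placed
-- independently into both subtrees, realizing all patterns on level n + 1.

module Submission where

open import Data.Bool using (Bool; true; false; _xor_; _∧_; not; if_then_else_; T)
open import Data.Bool.Properties
  using (xor-assoc; xor-comm; xor-identityʳ; ∧-identityʳ; ∧-zeroʳ; T-not-≡)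
open import Data.Bool.Solver using (module xor-∧-Solver)
open import Data.Fin using (Fin; zero; suc; _≟_)
open import Data.List using (List; []; _∷_; _++_; length; reverse; map; concat; concatMap)
open import Data.List.Properties
  using (++-assoc; ++-identityʳ; length-++; reverse-++; reverse-involutive; unfold-reverse; map-++; concat-++)
open import Data.Nat using (ℕ; zero; suc; _+_; _<_; _≤_; z≤n; s≤s)
open import Data.Nat.Properties using (+-monoʳ-<; <⇒≤; ≤-reflexive; suc-injective; m≤n⇒m<n∨m≡n)
open import Data.Product using (Σ; _×_; _,_; proj₁; proj₂; map₂)
open import Data.Sum using (inj₁; inj₂)
open import Data.Unit using (⊤; tt)
open import Relation.Nullary using (yes; no)
open import Function using (_∘_)
open import Function.Bundles using (Equivalence)
open import Relation.Binary.Bundles using (Setoid)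
open import Relation.Binary.PropositionalEquality
import Relation.Binary.Reasoning.Setoid as SetoidReasoning
open import Defs

open xor-∧-Solver using (solve; _:+_; _:*_; _:=_; con)

module ≗-Reasoning = SetoidReasoning (Word →-setoid Bool)
open Setoid (Word →-setoid Bool) using () renaming (sym to ≗-sym; trans to ≗-trans)

-- Automorphisms as portraits

flip-involutive : ∀ e c → flip e (flip e c) ≡ c
flip-involutive false c = refl
flip-involutive true a = refl
flip-involutive true b = refl

flip-xor : ∀ p q c → flip (p xor q) c ≡ flip q (flip p c)
flip-xor false q c = refl
flip-xor true false c = refl
flip-xor true true a = refl
flip-xor true true b = refl

child : Aut → Letter → Aut
child σ c y = σ (c ∷ y)

sec : Aut → Word → Aut
sec σ x y = σ (x ++ y)

act-cong : ∀ {σ τ} → σ ≗ τ → act σ ≗ act τ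
act-cong p [] = refl
act-cong p (c ∷ y) = cong₂ _∷_ (cong (λ e → flip e c) (p [])) (act-cong (λ z → p (c ∷ z)) y)

act-idₐ : ∀ y → act idₐ y ≡ y
act-idₐ [] = refl
act-idₐ (c ∷ y) = cong (c ∷_) (act-idₐ y)

act-++ : ∀ σ x y → act σ (x ++ y) ≡ act σ x ++ act (sec σ x) y
act-++ σ [] y = refl
act-++ σ (c ∷ x) y = cong (flip (σ []) c ∷_) (act-++ (child σ c) x y)

act-∘ₐ : ∀ σ τ → act (σ ∘ₐ τ) ≗ act σ ∘ act τ
act-∘ₐ σ τ [] = refl
act-∘ₐ σ τ (c ∷ y) =
  cong₂ _∷_ (flip-xor (τ []) (σ []) c) (act-∘ₐ (child σ (flip (τ []) c)) (child τ c) y)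

act-invAct : ∀ σ y → act σ (invAct σ y) ≡ y
act-invAct σ [] = refl
act-invAct σ (c ∷ y) =
  cong₂ _∷_ (flip-involutive (σ []) c) (act-invAct (child σ (flip (σ []) c)) y)

∘ₐ-assoc : ∀ σ τ ρ → (σ ∘ₐ τ) ∘ₐ ρ ≗ σ ∘ₐ (τ ∘ₐ ρ)
∘ₐ-assoc σ τ ρ x =
  trans (sym (xor-assoc (ρ x) (τ (act ρ x)) (σ (act τ (act ρ x)))))
        (cong (λ y → (ρ x xor τ (act ρ x)) xor σ y) (sym (act-∘ₐ τ ρ x)))

∘ₐ-congˡ : ∀ {σ σ′} τ → σ ≗ σ′ → σ ∘ₐ τ ≗ σ′ ∘ₐ τ
∘ₐ-congˡ τ p x = cong (τ x xor_) (p (act τ x))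

∘ₐ-congʳ : ∀ σ {τ τ′} → τ ≗ τ′ → σ ∘ₐ τ ≗ σ ∘ₐ τ′
∘ₐ-congʳ σ p x = cong₂ (λ u v → u xor σ v) (p x) (act-cong p x)

∘ₐ-cong : ∀ {σ σ′ τ τ′} → σ ≗ σ′ → τ ≗ τ′ → σ ∘ₐ τ ≗ σ′ ∘ₐ τ′
∘ₐ-cong {σ′ = σ′} {τ = τ} p q = ≗-trans (∘ₐ-congˡ τ p) (∘ₐ-congʳ σ′ q)

∘ₐ-identityˡ : ∀ σ → idₐ ∘ₐ σ ≗ σ
∘ₐ-identityˡ σ x = xor-identityʳ (σ x)

∘ₐ-identityʳ : ∀ σ → σ ∘ₐ idₐ ≗ σ
∘ₐ-identityʳ σ x = cong σ (act-idₐ x)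

sec-∘ₐ : ∀ σ τ x → sec (σ ∘ₐ τ) x ≗ sec σ (act τ x) ∘ₐ sec τ x
sec-∘ₐ σ τ x y = cong (λ z → τ (x ++ y) xor σ z) (act-++ τ x y)

inv-involution : ∀ σ → σ ∘ₐ σ ≗ idₐ → inv σ ≗ σ
inv-involution σ σσ≗1 x =
  trans (xor≡false⇒≡ (σ (invAct σ x)) _ (σσ≗1 (invAct σ x))) (cong σ (act-invAct σ x))
  where
  xor≡false⇒≡ : ∀ p q → p xor q ≡ false → p ≡ q
  xor≡false⇒≡ false false _ = refl
  xor≡false⇒≡ true true _ = refl

-- The generators and their sections

-- The states of the automaton generating Pink's group: the sections of
-- 1, α₁, α₂, α₃ are again among them.
data State : Set where
  s₀ s₁ s₂ s₃ : State

⟦_⟧ : State → Aut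
⟦ s₀ ⟧ = idₐ
⟦ s₁ ⟧ = α₁
⟦ s₂ ⟧ = α₂
⟦ s₃ ⟧ = α₃

next : State → Letter → State
next s₂ a = s₁
next s₃ a = s₂
next s₃ b = s₃
next _ _ = s₀

child-⟦⟧ : ∀ q c → child ⟦ q ⟧ c ≗ ⟦ next q c ⟧
child-⟦⟧ s₀ c z = refl
child-⟦⟧ s₁ c z = refl
child-⟦⟧ s₂ a [] = refl
child-⟦⟧ s₂ a (_ ∷ _) = refl
child-⟦⟧ s₂ b z = refl
child-⟦⟧ s₃ a [] = refl
child-⟦⟧ s₃ a (a ∷ []) = refl
child-⟦⟧ s₃ a (b ∷ []) = refl
child-⟦⟧ s₃ a (a ∷ _ ∷ _) = refl
child-⟦⟧ s₃ a (b ∷ _ ∷ _) = refl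
child-⟦⟧ s₃ b z = refl

reach : State → Word → State
reach q [] = q
reach q (c ∷ x) = reach (next q c) x

sec-⟦⟧ : ∀ q x → sec ⟦ q ⟧ x ≗ ⟦ reach q x ⟧
sec-⟦⟧ q [] z = refl
sec-⟦⟧ q (c ∷ x) z = trans (child-⟦⟧ q c (x ++ z)) (sec-⟦⟧ (next q c) x z)

⟦⟧-involutive : ∀ q → ⟦ q ⟧ ∘ₐ ⟦ q ⟧ ≗ idₐ
⟦⟧-involutive s₀ x = refl
⟦⟧-involutive s₁ [] = refl
⟦⟧-involutive s₁ (c ∷ y) = refl
⟦⟧-involutive s₂ [] = refl
⟦⟧-involutive s₂ (c ∷ y) =
  trans (∘ₐ-cong (child-⟦⟧ s₂ c) (child-⟦⟧ s₂ c) y) (⟦⟧-involutive (next s₂ c) y)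
⟦⟧-involutive s₃ [] = refl
⟦⟧-involutive s₃ (c ∷ y) =
  trans (∘ₐ-cong (child-⟦⟧ s₃ c) (child-⟦⟧ s₃ c) y) (⟦⟧-involutive (next s₃ c) y)

-- Words in the generators

pattern g₁ = zero
pattern g₂ = suc zero
pattern g₃ = suc (suc zero)

PosWord : Set
PosWord = List (Fin 3)

evalW : PosWord → Aut
evalW [] = idₐ
evalW (i ∷ w) = gen i ∘ₐ evalW w

evalW-++ : ∀ u v → evalW (u ++ v) ≗ evalW u ∘ₐ evalW v
evalW-++ [] v = ≗-sym (∘ₐ-identityˡ (evalW v))
evalW-++ (i ∷ u) v =
  ≗-trans (∘ₐ-congʳ (gen i) (evalW-++ u v)) (≗-sym (∘ₐ-assoc (gen i) (evalW u) (evalW v)))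

evalW-cong : ∀ {u v} → u ≡ v → evalW u ≗ evalW v
evalW-cong refl x = refl

gen-involutive : ∀ i → gen i ∘ₐ gen i ≗ idₐ
gen-involutive g₁ = ⟦⟧-involutive s₁
gen-involutive g₂ = ⟦⟧-involutive s₂
gen-involutive g₃ = ⟦⟧-involutive s₃

evalW-cancel : ∀ i w → evalW (i ∷ i ∷ w) ≗ evalW w
evalW-cancel i w = begin
  gen i ∘ₐ (gen i ∘ₐ evalW w)  ≈⟨ ∘ₐ-assoc (gen i) (gen i) (evalW w) ⟨
  (gen i ∘ₐ gen i) ∘ₐ evalW w  ≈⟨ ∘ₐ-congˡ (evalW w) (gen-involutive i) ⟩
  idₐ ∘ₐ evalW w               ≈⟨ ∘ₐ-identityˡ (evalW w) ⟩
  evalW w                      ∎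
  where open ≗-Reasoning

evalW-reverseʳ : ∀ w → evalW w ∘ₐ evalW (reverse w) ≗ idₐ
evalW-reverseʳ [] = ∘ₐ-identityˡ idₐ
evalW-reverseʳ (i ∷ w) = begin
  (gen i ∘ₐ W) ∘ₐ evalW (reverse (i ∷ w))
    ≈⟨ ∘ₐ-congʳ (gen i ∘ₐ W) (≗-trans (evalW-cong (unfold-reverse i w)) (evalW-++ (reverse w) (i ∷ []))) ⟩
  (gen i ∘ₐ W) ∘ₐ (W⁻ ∘ₐ (gen i ∘ₐ idₐ))
    ≈⟨ ∘ₐ-congʳ (gen i ∘ₐ W) (∘ₐ-congʳ W⁻ (∘ₐ-identityʳ (gen i))) ⟩
  (gen i ∘ₐ W) ∘ₐ (W⁻ ∘ₐ gen i)
    ≈⟨ ∘ₐ-assoc (gen i) W (W⁻ ∘ₐ gen i) ⟩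
  gen i ∘ₐ (W ∘ₐ (W⁻ ∘ₐ gen i))
    ≈⟨ ∘ₐ-congʳ (gen i) (∘ₐ-assoc W W⁻ (gen i)) ⟨
  gen i ∘ₐ ((W ∘ₐ W⁻) ∘ₐ gen i)
    ≈⟨ ∘ₐ-congʳ (gen i) (≗-trans (∘ₐ-congˡ (gen i) (evalW-reverseʳ w)) (∘ₐ-identityˡ (gen i))) ⟩
  gen i ∘ₐ gen i
    ≈⟨ gen-involutive i ⟩
  idₐ ∎
  where
  open ≗-Reasoning
  W = evalW w
  W⁻ = evalW (reverse w)

evalW-reverseˡ : ∀ w → evalW (reverse w) ∘ₐ evalW w ≗ idₐ
evalW-reverseˡ w = subst (λ v → evalW (reverse w) ∘ₐ evalW v ≗ idₐ) (reverse-involutive w)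
                         (evalW-reverseʳ (reverse w))

evalGen-positive : ∀ w → evalGen w ≗ evalW (map proj₁ w)
evalGen-positive [] x = refl
evalGen-positive ((i , false) ∷ w) = ∘ₐ-congʳ (gen i) (evalGen-positive w)
evalGen-positive ((i , true) ∷ w) =
  ∘ₐ-cong (inv-involution (gen i) (gen-involutive i)) (evalGen-positive w)

evalGen-unsigned : ∀ w → evalGen (map (_, false) w) ≡ evalW w
evalGen-unsigned [] = refl
evalGen-unsigned (i ∷ w) = cong (gen i ∘ₐ_) (evalGen-unsigned w)

push : Fin 3 → PosWord → PosWord
push i [] = i ∷ []
push i (j ∷ w) with i ≟ j
... | yes _ = w
... | no _ = i ∷ j ∷ w

evalW-push : ∀ i w → evalW (push i w) ≗ evalW (i ∷ w)
evalW-push i [] x = refl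
evalW-push i (j ∷ w) with i ≟ j
... | yes refl = ≗-sym (evalW-cancel i w)
... | no _ = λ x → refl

reduce : PosWord → PosWord
reduce [] = []
reduce (i ∷ w) = push i (reduce w)

evalW-reduce : ∀ w → evalW (reduce w) ≗ evalW w
evalW-reduce [] x = refl
evalW-reduce (i ∷ w) = ≗-trans (evalW-push i (reduce w)) (∘ₐ-congʳ (gen i) (evalW-reduce w))

genChild : Fin 3 → Letter → PosWord
genChild g₂ a = g₁ ∷ []
genChild g₃ a = g₂ ∷ []
genChild g₃ b = g₃ ∷ []
genChild _ _ = []

rootLabel : PosWord → Bool
rootLabel [] = false
rootLabel (i ∷ w) = rootLabel w xor gen i []

childWord : PosWord → Letter → PosWord
childWord [] c = []
childWord (i ∷ w) c = genChild i (flip (rootLabel w) c) ++ childWord w c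

-- The portrait of evalW w computed through words for the sections; unlike
-- evalW itself, this normalises fast enough for the explicit checks below.
portrait : PosWord → Word → Bool
portrait w [] = rootLabel w
portrait w (c ∷ y) = portrait (childWord w c) y

gen-child : ∀ i c → child (gen i) c ≗ evalW (genChild i c)
gen-child g₁ c z = refl
gen-child g₂ a z = ≗-trans (child-⟦⟧ s₂ a) (≗-sym (∘ₐ-identityʳ α₁)) z
gen-child g₂ b z = refl
gen-child g₃ a z = ≗-trans (child-⟦⟧ s₃ a) (≗-sym (∘ₐ-identityʳ α₂)) z
gen-child g₃ b z = ≗-sym (∘ₐ-identityʳ α₃) z

evalW-root : ∀ w → evalW w [] ≡ rootLabel w
evalW-root [] = refl
evalW-root (i ∷ w) = cong (_xor gen i []) (evalW-root w)

evalW-child : ∀ w c → child (evalW w) c ≗ evalW (childWord w c)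
evalW-child [] c y = refl
evalW-child (i ∷ w) c y = begin
  evalW w (c ∷ y) xor gen i (flip (evalW w []) c ∷ act (child (evalW w) c) y)
    ≡⟨ cong₂ (λ u v → u xor gen i v) (evalW-child w c y)
             (cong₂ (λ e t → flip e c ∷ t) (evalW-root w) (act-cong (evalW-child w c) y)) ⟩
  (child (gen i) (flip (rootLabel w) c) ∘ₐ evalW (childWord w c)) y
    ≡⟨ ∘ₐ-congˡ (evalW (childWord w c)) (gen-child i (flip (rootLabel w) c)) y ⟩
  (evalW (genChild i (flip (rootLabel w) c)) ∘ₐ evalW (childWord w c)) y
    ≡⟨ evalW-++ (genChild i (flip (rootLabel w) c)) (childWord w c) y ⟨
  evalW (childWord (i ∷ w) c) y ∎
  where open ≡-Reasoning

evalW-portrait : ∀ w → evalW w ≗ portrait w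
evalW-portrait w [] = evalW-root w
evalW-portrait w (c ∷ y) = trans (evalW-child w c y) (evalW-portrait (childWord w c) y)

child-by-reduction : ∀ u v c → reduce (childWord u c) ≡ reduce (childWord v c) →
                     child (evalW u) c ≗ child (evalW v) c
child-by-reduction u v c eq = begin
  child (evalW u) c              ≈⟨ evalW-child u c ⟩
  evalW (childWord u c)          ≈⟨ evalW-reduce (childWord u c) ⟨
  evalW (reduce (childWord u c)) ≈⟨ evalW-cong eq ⟩
  evalW (reduce (childWord v c)) ≈⟨ evalW-reduce (childWord v c) ⟩
  evalW (childWord v c)          ≈⟨ evalW-child v c ⟨
  child (evalW v) c              ∎
  where open ≗-Reasoning

evalW-by-reduction : ∀ u v → rootLabel u ≡ rootLabel v →
                     reduce (childWord u a) ≡ reduce (childWord v a) →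
                     reduce (childWord u b) ≡ reduce (childWord v b) → evalW u ≗ evalW v
evalW-by-reduction u v root ≡a ≡b [] = trans (evalW-root u) (trans root (sym (evalW-root v)))
evalW-by-reduction u v root ≡a ≡b (a ∷ y) = child-by-reduction u v a ≡a y
evalW-by-reduction u v root ≡a ≡b (b ∷ y) = child-by-reduction u v b ≡b y

-- Agreement below a level

AgreeBelow : ℕ → Aut → Aut → Set
AgreeBelow n σ τ = ∀ x → length x < n → σ x ≡ τ x

Table : ℕ → Set
Table zero = ⊤
Table (suc n) = Bool × Table n × Table n

tabulate : ∀ n → Aut → Table n
tabulate zero σ = tt
tabulate (suc n) σ = σ [] , tabulate n (child σ a) , tabulate n (child σ b)

lookup : ∀ {n} → Table n → Aut
lookup {zero} _ _ = false
lookup {suc n} (r , _ , _) [] = r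
lookup {suc n} (_ , l , _) (a ∷ y) = lookup l y
lookup {suc n} (_ , _ , t) (b ∷ y) = lookup t y

tabulate-agree : ∀ n {σ τ} → AgreeBelow n σ τ → tabulate n σ ≡ tabulate n τ
tabulate-agree zero _ = refl
tabulate-agree (suc n) p =
  cong₂ _,_ (p [] (s≤s z≤n)) (cong₂ _,_ (tabulate-agree n (λ x lt → p (a ∷ x) (s≤s lt)))
                                        (tabulate-agree n (λ x lt → p (b ∷ x) (s≤s lt))))

-- For an F reading finitely many explicit nodes of depth < n, this holds by refl.
Local : ∀ {A : Set} → ℕ → (Aut → A) → Set
Local n F = ∀ σ → F (lookup (tabulate n σ)) ≡ F σ

local-agree : ∀ {A : Set} n (F : Aut → A) → Local n F → ∀ {σ τ} → AgreeBelow n σ τ → F σ ≡ F τ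
local-agree n F loc {σ} {τ} p =
  trans (sym (loc σ)) (trans (cong (F ∘ lookup) (tabulate-agree n p)) (loc τ))

≗⇒agree : ∀ {n σ τ} → σ ≗ τ → AgreeBelow n σ τ
≗⇒agree p x _ = p x

sec-agree : ∀ x {k σ τ} → AgreeBelow (length x + k) σ τ → AgreeBelow k (sec σ x) (sec τ x)
sec-agree x {k} p y lt =
  p (x ++ y) (subst (_< length x + k) (sym (length-++ x)) (+-monoʳ-< (length x) lt))

-- The invariants are preserved by the generators

xor-interchange : ∀ p q r s → (p xor q) xor (r xor s) ≡ (p xor r) xor (q xor s)
xor-interchange = solve 4 (λ p q r s → (p :+ q) :+ (r :+ s) := (p :+ r) :+ (q :+ s)) refl

xorSum : List Word → Aut → Bool
xorSum [] u = false
xorSum (w ∷ []) u = u w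
xorSum (w ∷ w′ ∷ ws) u = u w xor xorSum (w′ ∷ ws) u

xorSum-xor : ∀ ws (u v : Aut) → xorSum ws (λ x → u x xor v x) ≡ xorSum ws u xor xorSum ws v
xorSum-xor [] u v = refl
xorSum-xor (w ∷ []) u v = refl
xorSum-xor (w ∷ w′ ∷ ws) u v =
  trans (cong ((u w xor v w) xor_) (xorSum-xor (w′ ∷ ws) u v))
        (xor-interchange (u w) (v w) (xorSum (w′ ∷ ws) u) (xorSum (w′ ∷ ws) v))

level₁ level₂ : List Word
level₁ = (a ∷ []) ∷ (b ∷ []) ∷ []
level₂ = (a ∷ a ∷ []) ∷ (a ∷ b ∷ []) ∷ (b ∷ a ∷ []) ∷ (b ∷ b ∷ []) ∷ []

-- The nodes of the summand of R(σ, x) for w = c d, relative to x c.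
rWords : Letter → List Word
rWords d = (d ∷ []) ∷ (d ∷ b ∷ []) ∷ (d ∷ a ∷ a ∷ []) ∷ (d ∷ a ∷ b ∷ []) ∷ []

sum₁ sum₂ sumR : Aut → Bool
sum₁ = xorSum level₁
sum₂ = xorSum level₂
sumR u = xorSum (rWords a) u xor xorSum (rWords b) u

Sums : Set
Sums = Bool × Bool × Bool

sums : Aut → Sums
sums u = sum₁ u , sum₂ u , sumR u

_⊕_ : Sums → Sums → Sums
(x , y , r) ⊕ (x′ , y′ , r′) = x xor x′ , y xor y′ , r xor r′

𝟘 : Sums
𝟘 = false , false , false

⊕-identityʳ : ∀ s → s ⊕ 𝟘 ≡ s
⊕-identityʳ (x , y , r) = cong₂ _,_ (xor-identityʳ x) (cong₂ _,_ (xor-identityʳ y) (xor-identityʳ r))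

sums-∘ₐ : ∀ h u → sums (h ∘ₐ u) ≡ sums u ⊕ sums (h ∘ act u)
sums-∘ₐ h u = cong₂ _,_ (xorSum-xor level₁ u h′) (cong₂ _,_ (xorSum-xor level₂ u h′)
  (trans (cong₂ _xor_ (xorSum-xor (rWords a) u h′) (xorSum-xor (rWords b) u h′))
         (xor-interchange (xorSum (rWords a) u) (xorSum (rWords a) h′)
                          (xorSum (rWords b) u) (xorSum (rWords b) h′))))
  where h′ = h ∘ act u

Δ : State → Bool → Sums
Δ s₂ x = true , false , true
Δ s₃ x = false , true , true xor x
Δ _ x = 𝟘

generator-sums : ∀ q u → sums (⟦ q ⟧ ∘ act u) ≡ Δ q (sum₁ u)
generator-sums s₀ u = refl
generator-sums s₁ u = refl
generator-sums s₂ u with u []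
... | false = refl
... | true = refl
generator-sums s₃ u with u [] | u (a ∷ []) | u (b ∷ []) | u (a ∷ a ∷ []) | u (b ∷ a ∷ [])
... | false | false | false | false | false = refl
... | false | false | false | false | true  = refl
... | false | false | false | true  | false = refl
... | false | false | false | true  | true  = refl
... | false | false | true  | false | false = refl
... | false | false | true  | false | true  = refl
... | false | false | true  | true  | false = refl
... | false | false | true  | true  | true  = refl
... | false | true  | false | false | false = refl
... | false | true  | false | false | true  = refl
... | false | true  | false | true  | false = refl
... | false | true  | false | true  | true  = refl
... | false | true  | true  | false | false = refl
... | false | true  | true  | false | true  = refl
... | false | true  | true  | true  | false = refl
... | false | true  | true  | true  | true  = refl
... | true  | false | false | false | false = refl
... | true  | false | false | false | true  = refl
... | true  | false | false | true  | false = refl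
... | true  | false | false | true  | true  = refl
... | true  | false | true  | false | false = refl
... | true  | false | true  | false | true  = refl
... | true  | false | true  | true  | false = refl
... | true  | false | true  | true  | true  = refl
... | true  | true  | false | false | false = refl
... | true  | true  | false | false | true  = refl
... | true  | true  | false | true  | false = refl
... | true  | true  | false | true  | true  = refl
... | true  | true  | true  | false | false = refl
... | true  | true  | true  | false | true  = refl
... | true  | true  | true  | true  | false = refl
... | true  | true  | true  | true  | true  = refl

rootInvariants : Aut → Bool × Bool × Bool
rootInvariants ρ = P-a ρ [] , P-b ρ [] , R ρ []

rootInvariants-cong : ∀ {σ τ} → σ ≗ τ → rootInvariants σ ≡ rootInvariants τ
rootInvariants-cong p = local-agree 5 rootInvariants (λ _ → refl) (≗⇒agree p)

sums-cong : ∀ {σ τ} → σ ≗ τ → sums σ ≡ sums τ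
sums-cong p = local-agree 4 sums (λ _ → refl) (≗⇒agree p)

combine : Sums → Sums → Bool × Bool × Bool
combine (x , y , r) (x′ , y′ , r′) = y xor x′ , y′ xor x , (r xor r′) xor (x ∧ x′)

rootInvariants-children : ∀ ρ → rootInvariants ρ ≡ combine (sums (child ρ a)) (sums (child ρ b))
rootInvariants-children ρ =
  cong (λ r → P-a ρ [] , P-b ρ [] , r xor (sum₁ (child ρ a) ∧ sum₁ (child ρ b)))
       (sym (xor-assoc (t (a ∷ a ∷ [])) (t (a ∷ b ∷ [])) (t (b ∷ a ∷ []) xor t (b ∷ b ∷ []))))
  where t = R-term ρ []

-- Only the children α₂, α₃ of α₃ produce corrections, and these cancel.
combine-Δ-cancel : ∀ q e s t →
  combine (s ⊕ Δ (next q (flip e a)) (proj₁ s)) (t ⊕ Δ (next q (flip e b)) (proj₁ t)) ≡ combine s t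
combine-Δ-cancel s₀ e s t = cong₂ combine (⊕-identityʳ s) (⊕-identityʳ t)
combine-Δ-cancel s₁ e s t = cong₂ combine (⊕-identityʳ s) (⊕-identityʳ t)
combine-Δ-cancel s₂ false s t = cong₂ combine (⊕-identityʳ s) (⊕-identityʳ t)
combine-Δ-cancel s₂ true s t = cong₂ combine (⊕-identityʳ s) (⊕-identityʳ t)
combine-Δ-cancel s₃ false (x , y , r) (x′ , y′ , r′) =
  cong₂ _,_ (solve 2 (λ y x′ → (y :+ con false) :+ (x′ :+ con false) := y :+ x′) refl y x′)
  (cong₂ _,_ (solve 2 (λ y′ x → (y′ :+ con true) :+ (x :+ con true) := y′ :+ x) refl y′ x)
             (solve 4 (λ x r x′ r′ → ((r :+ con true) :+ (r′ :+ (con true :+ x′)))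
                                        :+ ((x :+ con true) :* (x′ :+ con false))
                                     := (r :+ r′) :+ (x :* x′)) refl x r x′ r′))
combine-Δ-cancel s₃ true (x , y , r) (x′ , y′ , r′) =
  cong₂ _,_ (solve 2 (λ y x′ → (y :+ con true) :+ (x′ :+ con true) := y :+ x′) refl y x′)
  (cong₂ _,_ (solve 2 (λ y′ x → (y′ :+ con false) :+ (x :+ con false) := y′ :+ x) refl y′ x)
             (solve 4 (λ x r x′ r′ → ((r :+ (con true :+ x)) :+ (r′ :+ con true))
                                        :+ ((x :+ con false) :* (x′ :+ con true))
                                     := (r :+ r′) :+ (x :* x′)) refl x r x′ r′))

sums-⟦⟧∘ₐ : ∀ q u → sums (⟦ q ⟧ ∘ₐ u) ≡ sums u ⊕ Δ q (sum₁ u)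
sums-⟦⟧∘ₐ q u = trans (sums-∘ₐ ⟦ q ⟧ u) (cong (sums u ⊕_) (generator-sums q u))

rootInvariants-⟦⟧∘ₐ : ∀ q v → rootInvariants (⟦ q ⟧ ∘ₐ v) ≡ rootInvariants v
rootInvariants-⟦⟧∘ₐ q v = begin
  rootInvariants (⟦ q ⟧ ∘ₐ v)
    ≡⟨ rootInvariants-children (⟦ q ⟧ ∘ₐ v) ⟩
  combine (sums (child ⟦ q ⟧ (flip e a) ∘ₐ child v a)) (sums (child ⟦ q ⟧ (flip e b) ∘ₐ child v b))
    ≡⟨ cong₂ combine (shifted a) (shifted b) ⟩
  combine (sums (child v a) ⊕ Δ (next q (flip e a)) (sum₁ (child v a)))
          (sums (child v b) ⊕ Δ (next q (flip e b)) (sum₁ (child v b)))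
    ≡⟨ combine-Δ-cancel q e (sums (child v a)) (sums (child v b)) ⟩
  combine (sums (child v a)) (sums (child v b))
    ≡⟨ rootInvariants-children v ⟨
  rootInvariants v ∎
  where
  open ≡-Reasoning
  e = v []
  shifted : ∀ c → sums (child ⟦ q ⟧ (flip e c) ∘ₐ child v c)
                  ≡ sums (child v c) ⊕ Δ (next q (flip e c)) (sum₁ (child v c))
  shifted c = trans (sums-cong (∘ₐ-congˡ (child v c) (child-⟦⟧ q (flip e c))))
                    (sums-⟦⟧∘ₐ (next q (flip e c)) (child v c))

rootInvariants-sec-⟦⟧∘ₐ : ∀ q u x → rootInvariants (sec (⟦ q ⟧ ∘ₐ u) x) ≡ rootInvariants (sec u x)
rootInvariants-sec-⟦⟧∘ₐ q u x =
  trans (rootInvariants-cong (≗-trans (sec-∘ₐ ⟦ q ⟧ u x) (∘ₐ-congˡ (sec u x) (sec-⟦⟧ q (act u x)))))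
        (rootInvariants-⟦⟧∘ₐ (reach q (act u x)) (sec u x))

Vanishing : Aut → Set
Vanishing σ = ∀ x → rootInvariants (sec σ x) ≡ (false , false , false)

vanishing-⟦⟧∘ₐ : ∀ q u → Vanishing u → Vanishing (⟦ q ⟧ ∘ₐ u)
vanishing-⟦⟧∘ₐ q u v x = trans (rootInvariants-sec-⟦⟧∘ₐ q u x) (v x)

vanishing-cong : ∀ {σ τ} → σ ≗ τ → Vanishing σ → Vanishing τ
vanishing-cong p v x = trans (rootInvariants-cong (λ y → sym (p (x ++ y)))) (v x)

vanishing-evalW : ∀ w → Vanishing (evalW w)
vanishing-evalW [] x = refl
vanishing-evalW (g₁ ∷ w) = vanishing-⟦⟧∘ₐ s₁ (evalW w) (vanishing-evalW w)
vanishing-evalW (g₂ ∷ w) = vanishing-⟦⟧∘ₐ s₂ (evalW w) (vanishing-evalW w)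
vanishing-evalW (g₃ ∷ w) = vanishing-⟦⟧∘ₐ s₃ (evalW w) (vanishing-evalW w)

vanishing-closure : ∀ σ → GPink σ → Vanishing σ
vanishing-closure σ approx x with approx (length x + 5)
... | w , agree = begin
  rootInvariants (sec σ x)
    ≡⟨ local-agree 5 rootInvariants (λ _ → refl) (sec-agree x agree) ⟨
  rootInvariants (sec (evalGen w) x)
    ≡⟨ vanishing-cong (≗-sym (evalGen-positive w)) (vanishing-evalW (map proj₁ w)) x ⟩
  (false , false , false) ∎
  where open ≡-Reasoning

vanishing⇒B̃ : ∀ σ → Vanishing σ → B̃ σ
vanishing⇒B̃ σ v =
  ((false , λ x → cong proj₁ (v x) , cong (proj₁ ∘ proj₂) (v x)) ,
   (false , λ x → cong (proj₂ ∘ proj₂) (v x))) , refl , refl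

B̃⇒vanishing : ∀ σ → B̃ σ → Vanishing σ
B̃⇒vanishing σ (((_ , PaPb) , (_ , R≡)) , refl , refl) x =
  cong₂ _,_ (proj₁ (PaPb x)) (cong₂ _,_ (proj₂ (PaPb x)) (R≡ x))

-- The substitution L and conjugates of x

concatMap-++ : ∀ {A B : Set} (f : A → List B) u v →
               concatMap f (u ++ v) ≡ concatMap f u ++ concatMap f v
concatMap-++ f u v = trans (cong concat (map-++ f u v)) (sym (concat-++ (map f u) (map f v)))

reverse-concatMap : ∀ {A B : Set} (f : A → List B) → (∀ i → reverse (f i) ≡ f i) →
                    ∀ w → reverse (concatMap f w) ≡ concatMap f (reverse w)
reverse-concatMap f pal [] = refl
reverse-concatMap f pal (i ∷ w) = begin
  reverse (f i ++ concatMap f w)                 ≡⟨ reverse-++ (f i) (concatMap f w) ⟩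
  reverse (concatMap f w) ++ reverse (f i)       ≡⟨ cong₂ _++_ (reverse-concatMap f pal w) (pal i) ⟩
  concatMap f (reverse w) ++ f i                 ≡⟨ cong (concatMap f (reverse w) ++_) (++-identityʳ (f i)) ⟨
  concatMap f (reverse w) ++ concatMap f (i ∷ []) ≡⟨ concatMap-++ f (reverse w) (i ∷ []) ⟨
  concatMap f (reverse w ++ i ∷ [])              ≡⟨ cong (concatMap f) (unfold-reverse i w) ⟨
  concatMap f (reverse (i ∷ w))                  ∎
  where open ≡-Reasoning

concatMap-concat : ∀ {A C : Set} (f : A → List C) css →
                   concatMap f (concat css) ≡ concat (map (concatMap f) css)
concatMap-concat f [] = refl
concatMap-concat f (cs ∷ css) =
  trans (concatMap-++ f cs (concat css)) (cong (concatMap f cs ++_) (concatMap-concat f css))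

⟪_,_⟫ : Aut → Aut → Aut
⟪ f , g ⟫ [] = false
⟪ f , g ⟫ (a ∷ y) = f y
⟪ f , g ⟫ (b ∷ y) = g y

⟪⟫-cong : ∀ {f f′ g g′} → f ≗ f′ → g ≗ g′ → ⟪ f , g ⟫ ≗ ⟪ f′ , g′ ⟫
⟪⟫-cong p q [] = refl
⟪⟫-cong p q (a ∷ y) = p y
⟪⟫-cong p q (b ∷ y) = q y

⟪⟫-∘ₐ : ∀ f g f′ g′ → ⟪ f , g ⟫ ∘ₐ ⟪ f′ , g′ ⟫ ≗ ⟪ f ∘ₐ f′ , g ∘ₐ g′ ⟫
⟪⟫-∘ₐ f g f′ g′ [] = refl
⟪⟫-∘ₐ f g f′ g′ (a ∷ y) = refl
⟪⟫-∘ₐ f g f′ g′ (b ∷ y) = refl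

⟪⟫-children : ∀ {ρ f g} → ρ [] ≡ false → child ρ a ≗ f → child ρ b ≗ g → ρ ≗ ⟪ f , g ⟫
⟪⟫-children e p q [] = e
⟪⟫-children e p q (a ∷ y) = p y
⟪⟫-children e p q (b ∷ y) = q y

⟪idₐ,idₐ⟫ : idₐ ≗ ⟪ idₐ , idₐ ⟫
⟪idₐ,idₐ⟫ = ⟪⟫-children refl (λ _ → refl) (λ _ → refl)

α₁-conj-⟪⟫ : ∀ f g → α₁ ∘ₐ (⟪ f , g ⟫ ∘ₐ α₁) ≗ ⟪ g , f ⟫
α₁-conj-⟪⟫ f g [] = refl
α₁-conj-⟪⟫ f g (a ∷ y) = trans (xor-identityʳ _) (cong g (act-idₐ y))
α₁-conj-⟪⟫ f g (b ∷ y) = trans (xor-identityʳ _) (cong f (act-idₐ y))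

Lgen ψgen : Fin 3 → PosWord
Lgen g₁ = g₂ ∷ []
Lgen g₂ = g₃ ∷ []
Lgen g₃ = g₁ ∷ g₃ ∷ g₁ ∷ []
ψgen g₁ = []
ψgen g₂ = g₃ ∷ []
ψgen g₃ = g₂ ∷ []

Lgen-palindromic : ∀ i → reverse (Lgen i) ≡ Lgen i
Lgen-palindromic g₁ = refl
Lgen-palindromic g₂ = refl
Lgen-palindromic g₃ = refl

ψgen-palindromic : ∀ i → reverse (ψgen i) ≡ ψgen i
ψgen-palindromic g₁ = refl
ψgen-palindromic g₂ = refl
ψgen-palindromic g₃ = refl

L ψ : PosWord → PosWord
L = concatMap Lgen
ψ = concatMap ψgen

Lgen-eval : ∀ i → evalW (Lgen i) ≗ ⟪ gen i , evalW (ψgen i) ⟫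
Lgen-eval g₁ =
  ⟪⟫-children refl (≗-trans (evalW-child (Lgen g₁) a) (∘ₐ-identityʳ α₁)) (evalW-child (Lgen g₁) b)
Lgen-eval g₂ =
  ⟪⟫-children refl (≗-trans (evalW-child (Lgen g₂) a) (∘ₐ-identityʳ α₂)) (evalW-child (Lgen g₂) b)
Lgen-eval g₃ =
  ⟪⟫-children refl (≗-trans (evalW-child (Lgen g₃) a) (∘ₐ-identityʳ α₃)) (evalW-child (Lgen g₃) b)

L-eval : ∀ w → evalW (L w) ≗ ⟪ evalW w , evalW (ψ w) ⟫
L-eval [] = ⟪idₐ,idₐ⟫
L-eval (i ∷ w) = begin
  evalW (Lgen i ++ L w)
    ≈⟨ evalW-++ (Lgen i) (L w) ⟩
  evalW (Lgen i) ∘ₐ evalW (L w)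
    ≈⟨ ∘ₐ-cong (Lgen-eval i) (L-eval w) ⟩
  ⟪ gen i , evalW (ψgen i) ⟫ ∘ₐ ⟪ evalW w , evalW (ψ w) ⟫
    ≈⟨ ⟪⟫-∘ₐ (gen i) (evalW (ψgen i)) (evalW w) (evalW (ψ w)) ⟩
  ⟪ gen i ∘ₐ evalW w , evalW (ψgen i) ∘ₐ evalW (ψ w) ⟫
    ≈⟨ ⟪⟫-cong (λ _ → refl) (≗-sym (evalW-++ (ψgen i) (ψ w))) ⟩
  ⟪ evalW (i ∷ w) , evalW (ψ (i ∷ w)) ⟫ ∎
  where open ≗-Reasoning

conj : PosWord → Aut → Aut
conj h Y = evalW h ∘ₐ (Y ∘ₐ evalW (reverse h))

conj-cong : ∀ h {Y Z} → Y ≗ Z → conj h Y ≗ conj h Z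
conj-cong h p = ∘ₐ-congʳ (evalW h) (∘ₐ-congˡ (evalW (reverse h)) p)

evalW-conj : ∀ h m → evalW (h ++ m ++ reverse h) ≗ conj h (evalW m)
evalW-conj h m = ≗-trans (evalW-++ h (m ++ reverse h)) (∘ₐ-congʳ (evalW h) (evalW-++ m (reverse h)))

conj-∘ₐ : ∀ h Y Z → conj h Y ∘ₐ conj h Z ≗ conj h (Y ∘ₐ Z)
conj-∘ₐ h Y Z = begin
  (H ∘ₐ (Y ∘ₐ H⁻)) ∘ₐ (H ∘ₐ (Z ∘ₐ H⁻))
    ≈⟨ ∘ₐ-assoc H (Y ∘ₐ H⁻) (H ∘ₐ (Z ∘ₐ H⁻)) ⟩
  H ∘ₐ ((Y ∘ₐ H⁻) ∘ₐ (H ∘ₐ (Z ∘ₐ H⁻)))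
    ≈⟨ ∘ₐ-congʳ H (∘ₐ-assoc Y H⁻ (H ∘ₐ (Z ∘ₐ H⁻))) ⟩
  H ∘ₐ (Y ∘ₐ (H⁻ ∘ₐ (H ∘ₐ (Z ∘ₐ H⁻))))
    ≈⟨ ∘ₐ-congʳ H (∘ₐ-congʳ Y (∘ₐ-assoc H⁻ H (Z ∘ₐ H⁻))) ⟨
  H ∘ₐ (Y ∘ₐ ((H⁻ ∘ₐ H) ∘ₐ (Z ∘ₐ H⁻)))
    ≈⟨ ∘ₐ-congʳ H (∘ₐ-congʳ Y (∘ₐ-congˡ (Z ∘ₐ H⁻) (evalW-reverseˡ h))) ⟩
  H ∘ₐ (Y ∘ₐ (idₐ ∘ₐ (Z ∘ₐ H⁻)))
    ≈⟨ ∘ₐ-congʳ H (∘ₐ-congʳ Y (∘ₐ-identityˡ (Z ∘ₐ H⁻))) ⟩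
  H ∘ₐ (Y ∘ₐ (Z ∘ₐ H⁻))
    ≈⟨ ∘ₐ-congʳ H (∘ₐ-assoc Y Z H⁻) ⟨
  H ∘ₐ ((Y ∘ₐ Z) ∘ₐ H⁻) ∎
  where
  open ≗-Reasoning
  H = evalW h
  H⁻ = evalW (reverse h)

conj-idₐ : ∀ h → conj h idₐ ≗ idₐ
conj-idₐ h = ≗-trans (∘ₐ-congʳ (evalW h) (∘ₐ-identityˡ (evalW (reverse h)))) (evalW-reverseʳ h)

conj-L : ∀ g Y → conj (L g) ⟪ Y , idₐ ⟫ ≗ ⟪ conj g Y , idₐ ⟫
conj-L g Y = begin
  evalW (L g) ∘ₐ (⟪ Y , idₐ ⟫ ∘ₐ evalW (reverse (L g)))
    ≈⟨ ∘ₐ-cong (L-eval g) (∘ₐ-congʳ ⟪ Y , idₐ ⟫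
         (≗-trans (evalW-cong (reverse-concatMap Lgen Lgen-palindromic g)) (L-eval (reverse g)))) ⟩
  ⟪ G , Ψ ⟫ ∘ₐ (⟪ Y , idₐ ⟫ ∘ₐ ⟪ G⁻ , Ψ⁻ ⟫)
    ≈⟨ ∘ₐ-congʳ ⟪ G , Ψ ⟫ (⟪⟫-∘ₐ Y idₐ G⁻ Ψ⁻) ⟩
  ⟪ G , Ψ ⟫ ∘ₐ ⟪ Y ∘ₐ G⁻ , idₐ ∘ₐ Ψ⁻ ⟫
    ≈⟨ ⟪⟫-∘ₐ G Ψ (Y ∘ₐ G⁻) (idₐ ∘ₐ Ψ⁻) ⟩
  ⟪ conj g Y , Ψ ∘ₐ (idₐ ∘ₐ Ψ⁻) ⟫
    ≈⟨ ⟪⟫-cong (λ _ → refl) (≗-trans (∘ₐ-congʳ Ψ (≗-trans (∘ₐ-identityˡ Ψ⁻)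
         (evalW-cong (sym (reverse-concatMap ψgen ψgen-palindromic g))))) (evalW-reverseʳ (ψ g))) ⟩
  ⟪ conj g Y , idₐ ⟫ ∎
  where
  open ≗-Reasoning
  G = evalW g
  G⁻ = evalW (reverse g)
  Ψ = evalW (ψ g)
  Ψ⁻ = evalW (ψ (reverse g))

conj-++ : ∀ h g Y → conj (h ++ g) Y ≗ conj h (conj g Y)
conj-++ h g Y = begin
  evalW (h ++ g) ∘ₐ (Y ∘ₐ evalW (reverse (h ++ g)))
    ≈⟨ ∘ₐ-cong (evalW-++ h g)
               (∘ₐ-congʳ Y (≗-trans (evalW-cong (reverse-++ h g)) (evalW-++ (reverse g) (reverse h)))) ⟩
  (H ∘ₐ G) ∘ₐ (Y ∘ₐ (G⁻ ∘ₐ H⁻))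
    ≈⟨ ∘ₐ-assoc H G (Y ∘ₐ (G⁻ ∘ₐ H⁻)) ⟩
  H ∘ₐ (G ∘ₐ (Y ∘ₐ (G⁻ ∘ₐ H⁻)))
    ≈⟨ ∘ₐ-congʳ H (∘ₐ-congʳ G (∘ₐ-assoc Y G⁻ H⁻)) ⟨
  H ∘ₐ (G ∘ₐ ((Y ∘ₐ G⁻) ∘ₐ H⁻))
    ≈⟨ ∘ₐ-congʳ H (∘ₐ-assoc G (Y ∘ₐ G⁻) H⁻) ⟨
  H ∘ₐ (conj g Y ∘ₐ H⁻) ∎
  where
  open ≗-Reasoning
  H = evalW h
  G = evalW g
  H⁻ = evalW (reverse h)
  G⁻ = evalW (reverse g)

xWord : PosWord
xWord = g₁ ∷ g₂ ∷ g₃ ∷ g₁ ∷ g₃ ∷ g₂ ∷ []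

X : Aut
X = evalW xWord

ψ-xWord : evalW (ψ xWord) ≗ idₐ
ψ-xWord = ≗-sym (evalW-reduce (ψ xWord))

L-xWord : evalW (L xWord) ≗ evalW ((g₁ ∷ xWord ++ g₁ ∷ []) ++ (g₂ ∷ xWord ++ g₂ ∷ []))
L-xWord =
  evalW-by-reduction (L xWord) ((g₁ ∷ xWord ++ g₁ ∷ []) ++ (g₂ ∷ xWord ++ g₂ ∷ [])) refl refl refl

-- A K-form lists conjugators g and stands for the product of the g x g⁻¹.
KForm : Set
KForm = List PosWord

block : PosWord → PosWord
block g = g ++ xWord ++ reverse g

evalK : KForm → Aut
evalK c = evalW (concatMap block c)

evalK-++ : ∀ c d → evalK (c ++ d) ≗ evalK c ∘ₐ evalK d
evalK-++ c d =
  ≗-trans (evalW-cong (concatMap-++ block c d)) (evalW-++ (concatMap block c) (concatMap block d))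

evalK-∷ : ∀ g c → evalK (g ∷ c) ≗ conj g X ∘ₐ evalK c
evalK-∷ g c =
  ≗-trans (evalW-++ (block g) (concatMap block c)) (∘ₐ-congˡ (evalK c) (evalW-conj g xWord))

block-snoc : ∀ h j → block (h ++ j ∷ []) ≡ h ++ (j ∷ xWord ++ j ∷ []) ++ reverse h
block-snoc h j = begin
   (h ++ j ∷ []) ++ xWord ++ reverse (h ++ j ∷ [])
     ≡⟨ cong (λ t → (h ++ j ∷ []) ++ xWord ++ t) (reverse-++ h (j ∷ [])) ⟩
   (h ++ j ∷ []) ++ xWord ++ j ∷ reverse h
     ≡⟨ ++-assoc h (j ∷ []) (xWord ++ j ∷ reverse h) ⟩
   h ++ j ∷ xWord ++ j ∷ reverse h
     ≡⟨ cong (λ t → h ++ j ∷ t) (++-assoc xWord (j ∷ []) (reverse h)) ⟨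
   h ++ (j ∷ xWord ++ j ∷ []) ++ reverse h ∎
  where open ≡-Reasoning

-- Since L(x) = (α₁ x α₁)(α₂ x α₂), the two blocks multiply to
-- conj (L g) (L x) = L(g x g⁻¹) = (g x g⁻¹ , ψ(g) ψ(x) ψ(g)⁻¹), and ψ(x) = 1.
block-L-pair : ∀ g →
  evalW (block (L g ++ g₁ ∷ [])) ∘ₐ evalW (block (L g ++ g₂ ∷ [])) ≗ ⟪ conj g X , idₐ ⟫
block-L-pair g = begin
  evalW (block (h ++ g₁ ∷ [])) ∘ₐ evalW (block (h ++ g₂ ∷ []))
    ≈⟨ ∘ₐ-cong (≗-trans (evalW-cong (block-snoc h g₁)) (evalW-conj h A₁))
               (≗-trans (evalW-cong (block-snoc h g₂)) (evalW-conj h A₂)) ⟩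
  conj h (evalW A₁) ∘ₐ conj h (evalW A₂)
    ≈⟨ conj-∘ₐ h (evalW A₁) (evalW A₂) ⟩
  conj h (evalW A₁ ∘ₐ evalW A₂)
    ≈⟨ conj-cong h (≗-trans (≗-sym (evalW-++ A₁ A₂)) (≗-trans (≗-sym L-xWord) (L-eval xWord))) ⟩
  conj h ⟪ X , evalW (ψ xWord) ⟫
    ≈⟨ conj-cong h (⟪⟫-cong (λ _ → refl) ψ-xWord) ⟩
  conj h ⟪ X , idₐ ⟫
    ≈⟨ conj-L g X ⟩
  ⟪ conj g X , idₐ ⟫ ∎
  where
  open ≗-Reasoning
  h = L g
  A₁ = g₁ ∷ xWord ++ g₁ ∷ []
  A₂ = g₂ ∷ xWord ++ g₂ ∷ []

liftLeft : KForm → KForm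
liftLeft [] = []
liftLeft (g ∷ c) = (L g ++ g₁ ∷ []) ∷ (L g ++ g₂ ∷ []) ∷ liftLeft c

evalK-liftLeft : ∀ c → evalK (liftLeft c) ≗ ⟪ evalK c , idₐ ⟫
evalK-liftLeft [] = ⟪idₐ,idₐ⟫
evalK-liftLeft (g ∷ c) = begin
  evalW (block h₁ ++ block h₂ ++ concatMap block (liftLeft c))
    ≈⟨ ≗-trans (evalW-++ (block h₁) _) (∘ₐ-congʳ (evalW (block h₁)) (evalW-++ (block h₂) _)) ⟩
  evalW (block h₁) ∘ₐ (evalW (block h₂) ∘ₐ evalK (liftLeft c))
    ≈⟨ ∘ₐ-assoc (evalW (block h₁)) (evalW (block h₂)) (evalK (liftLeft c)) ⟨
  (evalW (block h₁) ∘ₐ evalW (block h₂)) ∘ₐ evalK (liftLeft c)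
    ≈⟨ ∘ₐ-cong (block-L-pair g) (evalK-liftLeft c) ⟩
  ⟪ conj g X , idₐ ⟫ ∘ₐ ⟪ evalK c , idₐ ⟫
    ≈⟨ ⟪⟫-∘ₐ (conj g X) idₐ (evalK c) idₐ ⟩
  ⟪ conj g X ∘ₐ evalK c , idₐ ∘ₐ idₐ ⟫
    ≈⟨ ⟪⟫-cong (≗-sym (evalK-∷ g c)) (∘ₐ-identityˡ idₐ) ⟩
  ⟪ evalK (g ∷ c) , idₐ ⟫ ∎
  where
  open ≗-Reasoning
  h₁ = L g ++ g₁ ∷ []
  h₂ = L g ++ g₂ ∷ []

evalK-conj : ∀ h c → evalK (map (h ++_) c) ≗ conj h (evalK c)
evalK-conj h [] = ≗-sym (conj-idₐ h)
evalK-conj h (g ∷ c) = begin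
  evalK (map (h ++_) (g ∷ c))
    ≈⟨ ≗-trans (evalK-∷ (h ++ g) (map (h ++_) c)) (∘ₐ-cong (conj-++ h g X) (evalK-conj h c)) ⟩
  conj h (conj g X) ∘ₐ conj h (evalK c)
    ≈⟨ conj-∘ₐ h (conj g X) (evalK c) ⟩
  conj h (conj g X ∘ₐ evalK c)
    ≈⟨ conj-cong h (evalK-∷ g c) ⟨
  conj h (evalK (g ∷ c)) ∎
  where open ≗-Reasoning

liftRight : KForm → KForm
liftRight c = map (g₁ ∷_) (liftLeft c)

evalK-liftRight : ∀ c → evalK (liftRight c) ≗ ⟪ idₐ , evalK c ⟫
evalK-liftRight c = begin
  evalK (map ((g₁ ∷ []) ++_) (liftLeft c))
    ≈⟨ evalK-conj (g₁ ∷ []) (liftLeft c) ⟩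
  conj (g₁ ∷ []) (evalK (liftLeft c))
    ≈⟨ conj-cong (g₁ ∷ []) (evalK-liftLeft c) ⟩
  evalW (g₁ ∷ []) ∘ₐ (⟪ evalK c , idₐ ⟫ ∘ₐ evalW (g₁ ∷ []))
    ≈⟨ ∘ₐ-cong (∘ₐ-identityʳ α₁) (∘ₐ-congʳ ⟪ evalK c , idₐ ⟫ (∘ₐ-identityʳ α₁)) ⟩
  α₁ ∘ₐ (⟪ evalK c , idₐ ⟫ ∘ₐ α₁)
    ≈⟨ α₁-conj-⟪⟫ (evalK c) idₐ ⟩
  ⟪ idₐ , evalK c ⟫ ∎
  where open ≗-Reasoning

evalK-lift : ∀ c d → evalK (liftLeft c ++ liftRight d) ≗ ⟪ evalK c , evalK d ⟫
evalK-lift c d = begin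
  evalK (liftLeft c ++ liftRight d)
    ≈⟨ evalK-++ (liftLeft c) (liftRight d) ⟩
  evalK (liftLeft c) ∘ₐ evalK (liftRight d)
    ≈⟨ ∘ₐ-cong (evalK-liftLeft c) (evalK-liftRight d) ⟩
  ⟪ evalK c , idₐ ⟫ ∘ₐ ⟪ idₐ , evalK d ⟫
    ≈⟨ ⟪⟫-∘ₐ (evalK c) idₐ idₐ (evalK d) ⟩
  ⟪ evalK c ∘ₐ idₐ , idₐ ∘ₐ evalK d ⟫
    ≈⟨ ⟪⟫-cong (∘ₐ-identityʳ (evalK c)) (∘ₐ-identityˡ (evalK d)) ⟩
  ⟪ evalK c , evalK d ⟫ ∎
  where open ≗-Reasoning

-- Realizing patterns on a level

TrivialBelow : ℕ → Aut → Set
TrivialBelow n ρ = ∀ z → length z < n → ρ z ≡ false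

OnLevel : ℕ → Aut → (Word → Bool) → Set
OnLevel n ρ v = ∀ y → length y ≡ n → ρ y ≡ v y

Realizes : ℕ → Aut → (Word → Bool) → Set
Realizes n ρ v = TrivialBelow n ρ × OnLevel n ρ v

realizes-cong : ∀ {n ρ ρ′ v} → ρ ≗ ρ′ → Realizes n ρ v → Realizes n ρ′ v
realizes-cong p (triv , lvl) =
  (λ z lt → trans (sym (p z)) (triv z lt)) , (λ y e → trans (sym (p y)) (lvl y e))

realizes-congʳ : ∀ {n ρ v v′} → (∀ y → v y ≡ v′ y) → Realizes n ρ v → Realizes n ρ v′
realizes-congʳ p (triv , lvl) = triv , λ y e → trans (lvl y e) (p y)

realizes-⟪⟫ : ∀ {n f g v} → Realizes n f (child v a) → Realizes n g (child v b) →
              Realizes (suc n) ⟪ f , g ⟫ v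
realizes-⟪⟫ (trivf , lvlf) (trivg , lvlg) = triv , lvl
  where
  triv : TrivialBelow _ _
  triv [] _ = refl
  triv (a ∷ z) (s≤s lt) = trivf z lt
  triv (b ∷ z) (s≤s lt) = trivg z lt
  lvl : OnLevel _ _ _
  lvl (a ∷ y) e = lvlf y (suc-injective e)
  lvl (b ∷ y) e = lvlg y (suc-injective e)

act-trivialBelow : ∀ n ρ y → TrivialBelow n ρ → length y ≤ n → act ρ y ≡ y
act-trivialBelow n ρ [] _ _ = refl
act-trivialBelow (suc n) ρ (c ∷ y) triv (s≤s le) rewrite triv [] (s≤s z≤n) =
  cong (c ∷_) (act-trivialBelow n (child ρ c) y (λ z lt → triv (c ∷ z) (s≤s lt)) le)

∘ₐ-trivialBelow : ∀ {n} σ ρ → TrivialBelow n ρ → ∀ y → length y ≤ n → (σ ∘ₐ ρ) y ≡ ρ y xor σ y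
∘ₐ-trivialBelow {n} σ ρ triv y le = cong (λ z → ρ y xor σ z) (act-trivialBelow n ρ y triv le)

realizes-∘ₐ : ∀ {n σ ρ v w} → Realizes n σ v → Realizes n ρ w →
              Realizes n (σ ∘ₐ ρ) (λ y → w y xor v y)
realizes-∘ₐ {σ = σ} {ρ} (trivσ , lvlσ) (trivρ , lvlρ) =
  (λ z lt → trans (∘ₐ-trivialBelow σ ρ trivρ z (<⇒≤ lt)) (cong₂ _xor_ (trivρ z lt) (trivσ z lt))) ,
  (λ y e → trans (∘ₐ-trivialBelow σ ρ trivρ y (≤-reflexive e)) (cong₂ _xor_ (lvlρ y e) (lvlσ y e)))

topA-words topB-words topR-words : List Word
topA-words = (a ∷ a ∷ a ∷ []) ∷ (a ∷ a ∷ b ∷ []) ∷ (a ∷ b ∷ a ∷ []) ∷ (a ∷ b ∷ b ∷ []) ∷ []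
topB-words = (b ∷ a ∷ a ∷ []) ∷ (b ∷ a ∷ b ∷ []) ∷ (b ∷ b ∷ a ∷ []) ∷ (b ∷ b ∷ b ∷ []) ∷ []
topR-words = (a ∷ a ∷ a ∷ a ∷ []) ∷ (a ∷ a ∷ a ∷ b ∷ []) ∷ (a ∷ b ∷ a ∷ a ∷ []) ∷ (a ∷ b ∷ a ∷ b ∷ [])
           ∷ (b ∷ a ∷ a ∷ a ∷ []) ∷ (b ∷ a ∷ a ∷ b ∷ []) ∷ (b ∷ b ∷ a ∷ a ∷ []) ∷ (b ∷ b ∷ a ∷ b ∷ []) ∷ []

-- The conditions on a pattern on level n coming from the parts of P^a, P^b at
-- nodes on level n − 3 and of R at nodes on level n − 4 that read level n.
Admissible : ℕ → (Word → Bool) → Set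
Admissible n v =
  (∀ x → length x + 3 ≡ n →
     xorSum topA-words (sec v x) ≡ false × xorSum topB-words (sec v x) ≡ false) ×
  (∀ x → length x + 4 ≡ n → xorSum topR-words (sec v x) ≡ false)

admissible-child : ∀ {n} v → Admissible (suc n) v → ∀ c → Admissible n (child v c)
admissible-child v (PQ , R≡) c = (λ x e → PQ (c ∷ x) (cong suc e)) , (λ x e → R≡ (c ∷ x) (cong suc e))

lowR : Aut → Bool
lowR ρ = xorSum ((a ∷ a ∷ []) ∷ (a ∷ a ∷ b ∷ []) ∷ (a ∷ b ∷ []) ∷ (a ∷ b ∷ b ∷ [])
               ∷ (b ∷ a ∷ []) ∷ (b ∷ a ∷ b ∷ []) ∷ (b ∷ b ∷ []) ∷ (b ∷ b ∷ b ∷ []) ∷ []) ρ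
         xor (sum₁ (child ρ a) ∧ sum₁ (child ρ b))

R-split : ∀ ρ → R ρ [] ≡ xorSum topR-words ρ xor lowR ρ
R-split ρ = solve 16
  (λ aa ab ba bb aab abb bab bbb aaaa aaab abaa abab baaa baab bbaa bbab →
     (((aa :+ (aab :+ (aaaa :+ aaab))) :+ ((ab :+ (abb :+ (abaa :+ abab)))
        :+ ((ba :+ (bab :+ (baaa :+ baab))) :+ (bb :+ (bbb :+ (bbaa :+ bbab))))))
        :+ ((aa :+ ab) :* (ba :+ bb)))
     := ((aaaa :+ (aaab :+ (abaa :+ (abab :+ (baaa :+ (baab :+ (bbaa :+ bbab)))))))
        :+ ((aa :+ (aab :+ (ab :+ (abb :+ (ba :+ (bab :+ (bb :+ bbb)))))))
        :+ ((aa :+ ab) :* (ba :+ bb)))))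
  refl
  (ρ (a ∷ a ∷ [])) (ρ (a ∷ b ∷ [])) (ρ (b ∷ a ∷ [])) (ρ (b ∷ b ∷ []))
  (ρ (a ∷ a ∷ b ∷ [])) (ρ (a ∷ b ∷ b ∷ [])) (ρ (b ∷ a ∷ b ∷ [])) (ρ (b ∷ b ∷ b ∷ []))
  (ρ (a ∷ a ∷ a ∷ a ∷ [])) (ρ (a ∷ a ∷ a ∷ b ∷ [])) (ρ (a ∷ b ∷ a ∷ a ∷ [])) (ρ (a ∷ b ∷ a ∷ b ∷ []))
  (ρ (b ∷ a ∷ a ∷ a ∷ [])) (ρ (b ∷ a ∷ a ∷ b ∷ [])) (ρ (b ∷ b ∷ a ∷ a ∷ [])) (ρ (b ∷ b ∷ a ∷ b ∷ []))

top-of-difference : ∀ n ws (F low : Aut → Bool) → (∀ ρ → F ρ ≡ xorSum ws ρ xor low ρ) → Local n low →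
  ∀ {ρ ρ′} → AgreeBelow n ρ ρ′ → F ρ ≡ false → F ρ′ ≡ false → xorSum ws (λ y → ρ y xor ρ′ y) ≡ false
top-of-difference n ws F low split loc {ρ} {ρ′} agree F≡ F′≡ = begin
  xorSum ws (λ y → ρ y xor ρ′ y)
    ≡⟨ xorSum-xor ws ρ ρ′ ⟩
  xorSum ws ρ xor xorSum ws ρ′
    ≡⟨ cancel (xorSum ws ρ) (xorSum ws ρ′) (low ρ) ⟨
  (xorSum ws ρ xor low ρ) xor (xorSum ws ρ′ xor low ρ)
    ≡⟨ cong₂ _xor_ (sym (split ρ))
                   (trans (cong (xorSum ws ρ′ xor_) (local-agree n low loc agree)) (sym (split ρ′))) ⟩
  F ρ xor F ρ′
    ≡⟨ cong₂ _xor_ F≡ F′≡ ⟩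
  false ∎
  where
  open ≡-Reasoning
  cancel : ∀ p q l → (p xor l) xor (q xor l) ≡ p xor q
  cancel = solve 3 (λ p q l → (p :+ l) :+ (q :+ l) := p :+ q) refl

admissible-difference : ∀ {n σ τ} → Vanishing σ → Vanishing τ → AgreeBelow n σ τ →
                        Admissible n (λ y → σ y xor τ y)
admissible-difference {σ = σ} {τ} vσ vτ agree = PQ , R≡
  where
  PQ : ∀ x → length x + 3 ≡ _ → _
  PQ x refl =
    top-of-difference 3 topA-words (λ ρ → P-a ρ []) (λ ρ → ρ (b ∷ a ∷ []) xor ρ (b ∷ b ∷ []))
      (λ _ → refl) (λ _ → refl) (sec-agree x agree) (cong proj₁ (vσ x)) (cong proj₁ (vτ x)) ,
    top-of-difference 3 topB-words (λ ρ → P-b ρ []) (λ ρ → ρ (a ∷ a ∷ []) xor ρ (a ∷ b ∷ []))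
      (λ _ → refl) (λ _ → refl) (sec-agree x agree) (cong (proj₁ ∘ proj₂) (vσ x)) (cong (proj₁ ∘ proj₂) (vτ x))
  R≡ : ∀ x → length x + 4 ≡ _ → _
  R≡ x refl =
    top-of-difference 4 topR-words (λ ρ → R ρ []) lowR R-split (λ _ → refl)
      (sec-agree x agree) (cong (proj₂ ∘ proj₂) (vσ x)) (cong (proj₂ ∘ proj₂) (vτ x))

LevelRealizable : ℕ → Set
LevelRealizable n = ∀ v → Admissible n v → Σ PosWord λ w → Realizes n (evalW w) v

KRealizable : ℕ → Set
KRealizable n = ∀ v → Admissible n v → Σ KForm λ c → Realizes n (evalK c) v

kRealizable-suc : ∀ {n} → KRealizable n → KRealizable (suc n)
kRealizable-suc real v adm
  with real (child v a) (admissible-child v adm a) | real (child v b) (admissible-child v adm b)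
... | c , rc | d , rd =
  liftLeft c ++ liftRight d , realizes-cong (≗-sym (evalK-lift c d)) (realizes-⟪⟫ rc rd)

kRealizable-≥4 : KRealizable 4 → ∀ m → KRealizable (4 + m)
kRealizable-≥4 real₄ zero = real₄
kRealizable-≥4 real₄ (suc m) = kRealizable-suc (kRealizable-≥4 real₄ m)

levelRealizable : LevelRealizable 0 → LevelRealizable 1 → LevelRealizable 2 → LevelRealizable 3 →
                  KRealizable 4 → ∀ n → LevelRealizable n
levelRealizable r₀ r₁ r₂ r₃ k₄ 0 = r₀
levelRealizable r₀ r₁ r₂ r₃ k₄ 1 = r₁
levelRealizable r₀ r₁ r₂ r₃ k₄ 2 = r₂
levelRealizable r₀ r₁ r₂ r₃ k₄ 3 = r₃
levelRealizable r₀ r₁ r₂ r₃ k₄ (suc (suc (suc (suc m)))) v adm with kRealizable-≥4 k₄ m v adm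
... | c , rc = concatMap block c , rc

extend-agreement : ∀ {n W C σ} → AgreeBelow n W σ → Realizes n C (λ y → W y xor σ y) →
                   AgreeBelow (suc n) (W ∘ₐ C) σ
extend-agreement {n} {W} {C} {σ} agree (triv , lvl) y (s≤s le) with m≤n⇒m<n∨m≡n le
... | inj₁ lt = trans (∘ₐ-trivialBelow W C triv y le) (trans (cong (_xor W y) (triv y lt)) (agree y lt))
... | inj₂ eq =
  trans (∘ₐ-trivialBelow W C triv y le) (trans (cong (_xor W y) (lvl y eq)) (xor-cancelˡ (W y) (σ y)))
  where
  xor-cancelˡ : ∀ p q → (p xor q) xor p ≡ q
  xor-cancelˡ = solve 2 (λ p q → (p :+ q) :+ p := q) refl

approximate : (∀ n → LevelRealizable n) →
              ∀ {σ} → Vanishing σ → ∀ n → Σ PosWord λ w → AgreeBelow n (evalW w) σ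
approximate real vσ zero = [] , λ _ ()
approximate real {σ} vσ (suc n) with approximate real vσ n
... | w , agree with real n (λ y → evalW w y xor σ y) (admissible-difference (vanishing-evalW w) vσ agree)
... | c , rc = w ++ c , λ y lt → trans (evalW-++ w c y) (extend-agreement agree rc y lt)

-- Explicit bases for the levels 0 to 4

AllBelow : ℕ → (Word → Bool) → Set
AllBelow zero f = ⊤
AllBelow (suc n) f = T (f []) × AllBelow n (f ∘ (a ∷_)) × AllBelow n (f ∘ (b ∷_))

allBelow-sound : ∀ n f → AllBelow n f → ∀ z → length z < n → T (f z)
allBelow-sound (suc n) f (h , _ , _) [] _ = h
allBelow-sound (suc n) f (_ , ha , _) (a ∷ z) (s≤s lt) = allBelow-sound n (f ∘ (a ∷_)) ha z lt
allBelow-sound (suc n) f (_ , _ , hb) (b ∷ z) (s≤s lt) = allBelow-sound n (f ∘ (b ∷_)) hb z lt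

-- Decided by computation when n and w are concrete.
PortraitTrivialBelow : ℕ → PosWord → Set
PortraitTrivialBelow n w = AllBelow n (not ∘ portrait w)

portraitTrivialBelow-sound : ∀ n w → PortraitTrivialBelow n w → TrivialBelow n (evalW w)
portraitTrivialBelow-sound n w h z lt =
  trans (evalW-portrait w z) (Equivalence.to T-not-≡ (allBelow-sound n (not ∘ portrait w) h z lt))

-- A basis pairs nodes y of a level with elements whose portrait on that level
-- is, modulo the admissibility conditions, the indicator of y.  An admissible
-- pattern v is realized by the product of the elements at the nodes where v
-- holds; the nodes missing from the basis are handled by the admissibility
-- conditions.
Basis : Set → Set
Basis A = List (Word × A)

select : ∀ {A : Set} → (Word → Bool) → Basis A → List A
select v [] = []
select v ((y , w) ∷ B) = if v y then w ∷ select v B else select v B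

select-map : ∀ {A C : Set} (f : A → C) v (B : Basis A) →
             map f (select v B) ≡ select v (map (map₂ f) B)
select-map f v [] = refl
select-map f v ((y , w) ∷ B) with v y
... | true = cong (f w ∷_) (select-map f v B)
... | false = select-map f v B

levelSum : (Word → Bool) → Basis PosWord → Word → Bool
levelSum v [] z = false
levelSum v ((y , w) ∷ B) z = (portrait w z ∧ v y) xor levelSum v B z

BasisTrivialBelow : ℕ → Basis PosWord → Set
BasisTrivialBelow n [] = ⊤
BasisTrivialBelow n ((_ , w) ∷ B) = PortraitTrivialBelow n w × BasisTrivialBelow n B

realizes-select : ∀ n (B : Basis PosWord) → BasisTrivialBelow n B →
                  ∀ v → Realizes n (evalW (concat (select v B))) (levelSum v B)
realizes-select n [] _ v = (λ _ _ → refl) , (λ _ _ → refl)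
realizes-select n ((y , w) ∷ B) (hw , hB) v with v y
... | false =
  realizes-congʳ (λ z → cong (_xor levelSum v B z) (sym (∧-zeroʳ (portrait w z)))) (realizes-select n B hB v)
... | true = realizes-cong (≗-sym (evalW-++ w (concat (select v B))))
  (realizes-congʳ reorder
    (realizes-∘ₐ (portraitTrivialBelow-sound n w hw , λ z _ → evalW-portrait w z) (realizes-select n B hB v)))
  where
  reorder : ∀ z → levelSum v B z xor portrait w z ≡ (portrait w z ∧ true) xor levelSum v B z
  reorder z = trans (xor-comm (levelSum v B z) (portrait w z))
                    (cong (_xor levelSum v B z) (sym (∧-identityʳ (portrait w z))))

levelRealizable-basis : ∀ n (B : Basis PosWord) → BasisTrivialBelow n B →
  (∀ v → Admissible n v → OnLevel n (levelSum v B) v) → LevelRealizable n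
levelRealizable-basis n B triv levels v adm with realizes-select n B triv v
... | t , l = concat (select v B) , t , λ y e → trans (l y e) (levels v adm y e)

kRealizable-basis : ∀ n (B : Basis KForm) → BasisTrivialBelow n (map (map₂ (concatMap block)) B) →
  (∀ v → Admissible n v → OnLevel n (levelSum v (map (map₂ (concatMap block)) B)) v) → KRealizable n
kRealizable-basis n B triv levels v adm =
  concat (select v B) ,
  realizes-cong (evalW-cong (sym same-word)) (proj₂ (levelRealizable-basis n B′ triv levels v adm))
  where
  B′ = map (map₂ (concatMap block)) B
  same-word : concatMap block (concat (select v B)) ≡ concat (select v B′)
  same-word = trans (concatMap-concat block (select v B)) (cong concat (select-map (concatMap block) v B))

basis₀ : Basis PosWord
basis₀ =
    ([] , g₁ ∷ [])
  ∷ []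

basis₁ : Basis PosWord
basis₁ =
    (a ∷ [] , g₂ ∷ [])
  ∷ (b ∷ [] , g₁ ∷ g₂ ∷ g₁ ∷ [])
  ∷ []

basis₂ : Basis PosWord
basis₂ =
    (a ∷ a ∷ [] , g₃ ∷ [])
  ∷ (a ∷ b ∷ [] , g₂ ∷ g₃ ∷ g₂ ∷ [])
  ∷ (b ∷ a ∷ [] , g₁ ∷ g₃ ∷ g₁ ∷ [])
  ∷ (b ∷ b ∷ [] , g₁ ∷ g₂ ∷ g₃ ∷ g₂ ∷ g₁ ∷ [])
  ∷ []

basis₃ : Basis PosWord
basis₃ =
    (a ∷ a ∷ a ∷ [] , g₃ ∷ g₂ ∷ g₃ ∷ g₁ ∷ g₃ ∷ g₁ ∷ g₃ ∷ g₂ ∷ g₃ ∷ g₁ ∷ g₃ ∷ g₁ ∷ [])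
  ∷ (a ∷ a ∷ b ∷ [] , g₃ ∷ g₁ ∷ g₃ ∷ g₁ ∷ g₃ ∷ g₂ ∷ g₃ ∷ g₁ ∷ g₃ ∷ g₁ ∷ g₃ ∷ g₂ ∷ [])
  ∷ (a ∷ b ∷ a ∷ [] , g₂ ∷ g₃ ∷ g₁ ∷ g₂ ∷ g₃ ∷ g₂ ∷ g₁ ∷ g₃ ∷ g₁ ∷ g₂ ∷ g₃ ∷ g₂ ∷ g₁ ∷ g₂ ∷ [])
  ∷ (b ∷ a ∷ a ∷ [] , g₃ ∷ g₁ ∷ g₃ ∷ g₂ ∷ g₃ ∷ g₁ ∷ g₃ ∷ g₁ ∷ g₃ ∷ g₂ ∷ g₃ ∷ g₁ ∷ [])
  ∷ (b ∷ a ∷ b ∷ [] , g₁ ∷ g₃ ∷ g₁ ∷ g₃ ∷ g₁ ∷ g₃ ∷ g₂ ∷ g₃ ∷ g₁ ∷ g₃ ∷ g₁ ∷ g₃ ∷ g₂ ∷ g₁ ∷ [])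
  ∷ (b ∷ b ∷ a ∷ [] , g₁ ∷ g₂ ∷ g₃ ∷ g₁ ∷ g₂ ∷ g₃ ∷ g₂ ∷ g₁ ∷ g₃ ∷ g₁ ∷ g₂ ∷ g₃ ∷ g₂ ∷ g₁ ∷ g₂ ∷ g₁ ∷ [])
  ∷ []

basis₄ : Basis KForm
basis₄ =
    (a ∷ a ∷ a ∷ b ∷ [] ,
       [] ∷ (g₂ ∷ []) ∷ (g₃ ∷ g₁ ∷ g₃ ∷ g₁ ∷ []) ∷ (g₂ ∷ g₁ ∷ g₃ ∷ g₁ ∷ g₃ ∷ []) ∷ [])
  ∷ (a ∷ a ∷ b ∷ a ∷ [] ,
       [] ∷ (g₃ ∷ []) ∷ (g₃ ∷ g₁ ∷ g₃ ∷ g₁ ∷ g₃ ∷ []) ∷ (g₃ ∷ g₁ ∷ g₃ ∷ g₁ ∷ []) ∷ [])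
  ∷ (a ∷ b ∷ a ∷ a ∷ [] ,
       [] ∷ (g₁ ∷ g₃ ∷ g₁ ∷ g₂ ∷ g₁ ∷ []) ∷ (g₂ ∷ g₁ ∷ g₃ ∷ g₂ ∷ []) ∷ (g₂ ∷ g₁ ∷ g₃ ∷ g₁ ∷ g₃ ∷ []) ∷ [])
  ∷ (a ∷ b ∷ a ∷ b ∷ [] ,
       (g₁ ∷ []) ∷ (g₂ ∷ g₁ ∷ g₃ ∷ g₂ ∷ []) ∷ (g₂ ∷ g₁ ∷ g₃ ∷ g₁ ∷ g₃ ∷ []) ∷ (g₁ ∷ g₃ ∷ g₁ ∷ g₂ ∷ []) ∷ [])
  ∷ (a ∷ b ∷ b ∷ a ∷ [] ,
       [] ∷ (g₂ ∷ g₃ ∷ g₁ ∷ []) ∷ (g₂ ∷ g₃ ∷ g₁ ∷ g₂ ∷ []) ∷ (g₁ ∷ g₃ ∷ g₁ ∷ g₂ ∷ g₃ ∷ []) ∷ [])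
  ∷ (b ∷ a ∷ a ∷ a ∷ [] ,
       [] ∷ (g₂ ∷ g₁ ∷ g₃ ∷ g₁ ∷ g₂ ∷ []) ∷ (g₂ ∷ g₁ ∷ g₃ ∷ g₁ ∷ g₂ ∷ []) ∷ (g₂ ∷ g₁ ∷ g₂ ∷ []) ∷ [])
  ∷ (b ∷ a ∷ a ∷ b ∷ [] ,
       (g₁ ∷ []) ∷ (g₁ ∷ g₃ ∷ g₂ ∷ g₁ ∷ g₃ ∷ []) ∷ (g₁ ∷ g₃ ∷ g₂ ∷ g₃ ∷ []) ∷ (g₃ ∷ g₂ ∷ g₁ ∷ g₂ ∷ g₃ ∷ []) ∷ [])
  ∷ (b ∷ a ∷ b ∷ a ∷ [] ,
       [] ∷ (g₁ ∷ g₂ ∷ g₃ ∷ g₂ ∷ []) ∷ (g₃ ∷ g₁ ∷ g₃ ∷ g₂ ∷ g₃ ∷ []) ∷ (g₁ ∷ g₃ ∷ g₂ ∷ g₁ ∷ g₃ ∷ []) ∷ [])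
  ∷ (b ∷ b ∷ a ∷ a ∷ [] ,
       [] ∷ (g₂ ∷ g₁ ∷ g₃ ∷ g₁ ∷ g₃ ∷ []) ∷ (g₁ ∷ g₂ ∷ g₁ ∷ g₃ ∷ g₁ ∷ []) ∷ (g₃ ∷ g₁ ∷ g₃ ∷ g₁ ∷ g₃ ∷ []) ∷ [])
  ∷ (b ∷ b ∷ a ∷ b ∷ [] ,
       (g₂ ∷ []) ∷ (g₁ ∷ g₂ ∷ g₃ ∷ g₁ ∷ []) ∷ (g₃ ∷ g₁ ∷ g₂ ∷ g₃ ∷ g₂ ∷ []) ∷ (g₁ ∷ g₂ ∷ g₃ ∷ g₁ ∷ g₂ ∷ []) ∷ [])
  ∷ (b ∷ b ∷ b ∷ a ∷ [] ,
       [] ∷ (g₂ ∷ []) ∷ (g₂ ∷ g₃ ∷ g₁ ∷ []) ∷ (g₂ ∷ g₁ ∷ g₂ ∷ g₃ ∷ []) ∷ [])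
  ∷ []

xor-last : ∀ p q r s → p xor q xor r xor s ≡ false → p xor q xor r xor false ≡ s
xor-last p q r s h = trans (regroup p q r s) (trans (cong (s xor_) h) (xor-identityʳ s))
  where
  regroup : ∀ p q r s → p xor q xor r xor false ≡ s xor (p xor q xor r xor s)
  regroup = solve 4 (λ p q r s → p :+ (q :+ (r :+ con false)) := s :+ (p :+ (q :+ (r :+ s)))) refl

levels₀ : ∀ v → Admissible 0 v → OnLevel 0 (levelSum v basis₀) v
levels₀ v _ [] _ = xor-identityʳ (v [])

levels₁ : ∀ v → Admissible 1 v → OnLevel 1 (levelSum v basis₁) v
levels₁ v _ (a ∷ []) _ = xor-identityʳ (v (a ∷ []))
levels₁ v _ (b ∷ []) _ = xor-identityʳ (v (b ∷ []))

levels₂ : ∀ v → Admissible 2 v → OnLevel 2 (levelSum v basis₂) v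
levels₂ v _ (a ∷ a ∷ []) _ = xor-identityʳ (v (a ∷ a ∷ []))
levels₂ v _ (a ∷ b ∷ []) _ = xor-identityʳ (v (a ∷ b ∷ []))
levels₂ v _ (b ∷ a ∷ []) _ = xor-identityʳ (v (b ∷ a ∷ []))
levels₂ v _ (b ∷ b ∷ []) _ = xor-identityʳ (v (b ∷ b ∷ []))

levels₃ : ∀ v → Admissible 3 v → OnLevel 3 (levelSum v basis₃) v
levels₃ v _ (a ∷ a ∷ a ∷ []) _ = xor-identityʳ (v (a ∷ a ∷ a ∷ []))
levels₃ v _ (a ∷ a ∷ b ∷ []) _ = xor-identityʳ (v (a ∷ a ∷ b ∷ []))
levels₃ v _ (a ∷ b ∷ a ∷ []) _ = xor-identityʳ (v (a ∷ b ∷ a ∷ []))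
levels₃ v (PQ , _) (a ∷ b ∷ b ∷ []) _ =
  xor-last (v (a ∷ a ∷ a ∷ [])) (v (a ∷ a ∷ b ∷ [])) (v (a ∷ b ∷ a ∷ [])) (v (a ∷ b ∷ b ∷ [])) (proj₁ (PQ [] refl))
levels₃ v _ (b ∷ a ∷ a ∷ []) _ = xor-identityʳ (v (b ∷ a ∷ a ∷ []))
levels₃ v _ (b ∷ a ∷ b ∷ []) _ = xor-identityʳ (v (b ∷ a ∷ b ∷ []))
levels₃ v _ (b ∷ b ∷ a ∷ []) _ = xor-identityʳ (v (b ∷ b ∷ a ∷ []))
levels₃ v (PQ , _) (b ∷ b ∷ b ∷ []) _ =
  xor-last (v (b ∷ a ∷ a ∷ [])) (v (b ∷ a ∷ b ∷ [])) (v (b ∷ b ∷ a ∷ [])) (v (b ∷ b ∷ b ∷ [])) (proj₂ (PQ [] refl))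

levels₄ : ∀ v → Admissible 4 v → OnLevel 4 (levelSum v (map (map₂ (concatMap block)) basis₄)) v
levels₄ v (_ , R≡) (a ∷ a ∷ a ∷ a ∷ []) _ =
  trans (regroup (v (a ∷ a ∷ a ∷ a ∷ [])) (v (a ∷ a ∷ a ∷ b ∷ [])) (v (a ∷ b ∷ a ∷ a ∷ [])) (v (a ∷ b ∷ a ∷ b ∷ []))
                 (v (b ∷ a ∷ a ∷ a ∷ [])) (v (b ∷ a ∷ a ∷ b ∷ [])) (v (b ∷ b ∷ a ∷ a ∷ [])) (v (b ∷ b ∷ a ∷ b ∷ [])))
        (trans (cong (v (a ∷ a ∷ a ∷ a ∷ []) xor_) (R≡ [] refl)) (xor-identityʳ (v (a ∷ a ∷ a ∷ a ∷ []))))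
  where
  regroup : ∀ p₀ p₁ p₂ p₃ p₄ p₅ p₆ p₇ →
    p₁ xor p₂ xor p₃ xor p₄ xor p₅ xor p₆ xor p₇ xor false
      ≡ p₀ xor (p₀ xor p₁ xor p₂ xor p₃ xor p₄ xor p₅ xor p₆ xor p₇)
  regroup = solve 8 (λ p₀ p₁ p₂ p₃ p₄ p₅ p₆ p₇ →
    p₁ :+ (p₂ :+ (p₃ :+ (p₄ :+ (p₅ :+ (p₆ :+ (p₇ :+ con false))))))
    := p₀ :+ (p₀ :+ (p₁ :+ (p₂ :+ (p₃ :+ (p₄ :+ (p₅ :+ (p₆ :+ p₇)))))))) refl
levels₄ v _ (a ∷ a ∷ a ∷ b ∷ []) _ = xor-identityʳ (v (a ∷ a ∷ a ∷ b ∷ []))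
levels₄ v _ (a ∷ a ∷ b ∷ a ∷ []) _ = xor-identityʳ (v (a ∷ a ∷ b ∷ a ∷ []))
levels₄ v (PQ , R≡) (a ∷ a ∷ b ∷ b ∷ []) _ =
  trans (regroup (v (a ∷ a ∷ a ∷ a ∷ [])) (v (a ∷ a ∷ a ∷ b ∷ [])) (v (a ∷ a ∷ b ∷ a ∷ [])) (v (a ∷ a ∷ b ∷ b ∷ []))
                 (v (a ∷ b ∷ a ∷ a ∷ [])) (v (a ∷ b ∷ a ∷ b ∷ [])) (v (b ∷ a ∷ a ∷ a ∷ [])) (v (b ∷ a ∷ a ∷ b ∷ []))
                 (v (b ∷ b ∷ a ∷ a ∷ [])) (v (b ∷ b ∷ a ∷ b ∷ [])))
        (trans (cong (λ t → v (a ∷ a ∷ b ∷ b ∷ []) xor t) (cong₂ _xor_ (proj₁ (PQ (a ∷ []) refl)) (R≡ [] refl)))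
               (xor-identityʳ (v (a ∷ a ∷ b ∷ b ∷ []))))
  where
  regroup : ∀ q₀ q₁ q₂ q₃ p₂ p₃ p₄ p₅ p₆ p₇ →
    q₂ xor p₂ xor p₃ xor p₄ xor p₅ xor p₆ xor p₇ xor false
      ≡ q₃ xor ((q₀ xor q₁ xor q₂ xor q₃) xor (q₀ xor q₁ xor p₂ xor p₃ xor p₄ xor p₅ xor p₆ xor p₇))
  regroup = solve 10 (λ q₀ q₁ q₂ q₃ p₂ p₃ p₄ p₅ p₆ p₇ →
    q₂ :+ (p₂ :+ (p₃ :+ (p₄ :+ (p₅ :+ (p₆ :+ (p₇ :+ con false))))))
    := q₃ :+ ((q₀ :+ (q₁ :+ (q₂ :+ q₃))) :+ (q₀ :+ (q₁ :+ (p₂ :+ (p₃ :+ (p₄ :+ (p₅ :+ (p₆ :+ p₇))))))))) refl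
levels₄ v _ (a ∷ b ∷ a ∷ a ∷ []) _ = xor-identityʳ (v (a ∷ b ∷ a ∷ a ∷ []))
levels₄ v _ (a ∷ b ∷ a ∷ b ∷ []) _ = xor-identityʳ (v (a ∷ b ∷ a ∷ b ∷ []))
levels₄ v _ (a ∷ b ∷ b ∷ a ∷ []) _ = xor-identityʳ (v (a ∷ b ∷ b ∷ a ∷ []))
levels₄ v (PQ , _) (a ∷ b ∷ b ∷ b ∷ []) _ =
  xor-last (v (a ∷ b ∷ a ∷ a ∷ [])) (v (a ∷ b ∷ a ∷ b ∷ [])) (v (a ∷ b ∷ b ∷ a ∷ [])) (v (a ∷ b ∷ b ∷ b ∷ []))
           (proj₂ (PQ (a ∷ []) refl))
levels₄ v _ (b ∷ a ∷ a ∷ a ∷ []) _ = xor-identityʳ (v (b ∷ a ∷ a ∷ a ∷ []))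
levels₄ v _ (b ∷ a ∷ a ∷ b ∷ []) _ = xor-identityʳ (v (b ∷ a ∷ a ∷ b ∷ []))
levels₄ v _ (b ∷ a ∷ b ∷ a ∷ []) _ = xor-identityʳ (v (b ∷ a ∷ b ∷ a ∷ []))
levels₄ v (PQ , _) (b ∷ a ∷ b ∷ b ∷ []) _ =
  xor-last (v (b ∷ a ∷ a ∷ a ∷ [])) (v (b ∷ a ∷ a ∷ b ∷ [])) (v (b ∷ a ∷ b ∷ a ∷ [])) (v (b ∷ a ∷ b ∷ b ∷ []))
           (proj₁ (PQ (b ∷ []) refl))
levels₄ v _ (b ∷ b ∷ a ∷ a ∷ []) _ = xor-identityʳ (v (b ∷ b ∷ a ∷ a ∷ []))
levels₄ v _ (b ∷ b ∷ a ∷ b ∷ []) _ = xor-identityʳ (v (b ∷ b ∷ a ∷ b ∷ []))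
levels₄ v _ (b ∷ b ∷ b ∷ a ∷ []) _ = xor-identityʳ (v (b ∷ b ∷ b ∷ a ∷ []))
levels₄ v (PQ , _) (b ∷ b ∷ b ∷ b ∷ []) _ =
  xor-last (v (b ∷ b ∷ a ∷ a ∷ [])) (v (b ∷ b ∷ a ∷ b ∷ [])) (v (b ∷ b ∷ b ∷ a ∷ [])) (v (b ∷ b ∷ b ∷ b ∷ []))
           (proj₂ (PQ (b ∷ []) refl))

realizable : ∀ n → LevelRealizable n
realizable = levelRealizable
  (levelRealizable-basis 0 basis₀ _ levels₀) (levelRealizable-basis 1 basis₁ _ levels₁)
  (levelRealizable-basis 2 basis₂ _ levels₂) (levelRealizable-basis 3 basis₃ _ levels₃)
  (kRealizable-basis 4 basis₄ basis₄-trivial levels₄)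
  where
  basis₄-trivial : BasisTrivialBelow 4 (map (map₂ (concatMap block)) basis₄)
  basis₄-trivial = _

vanishing⇒GPink : ∀ σ → Vanishing σ → GPink σ
vanishing⇒GPink σ vσ n =
  map (_, false) w , λ x lt → trans (cong (λ f → f x) (evalGen-unsigned w)) (agree x lt)
  where
  approximation = approximate realizable {σ} vσ n
  w = proj₁ approximation
  agree = proj₂ approximation

theorem6p5 : (∀ (σ : Aut) → GPink σ → B̃ σ) × (∀ (σ : Aut) → B̃ σ → GPink σ)
theorem6p5 = (λ σ → vanishing⇒B̃ σ ∘ vanishing-closure σ) , (λ σ → vanishing⇒GPink σ ∘ B̃⇒vanishing σ)
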